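{- The sets $S_1$ and $S_{ -1}$ are singleton sets.
   Context: $\mathbb{N}$ denotes the positive integers. For $u\in\mathbb{Z}[x]$ of degree at least 1, $u^{(1)}=u$ and $u^{(n+1)}=u\circ u^{(n)}$. $u$ is locally nilpotent at $r\in\mathbb{Z}$ if for every prime $p$ there is $m\in\mathbb{N}$ with $u^{(m)}(r)\equiv 0\pmod p$; $u$ is nilpotent at $r$ if $u^{(n)}(r)=0$ for some $n\in\mathbb{N}$. $S_r$ is the set of polynomials in $\mathbb{Z}[x]$ of degree at least 1 that are locally nilpotent at $r$ but not nilpotent at $r$. -}

module Defs where

open import Data.Nat as ℕ using (ℕ; zero; suc)
open import Data.Nat.Primality using (Prime)
open import Data.Integer using (ℤ; +_; -_; _+_; _*_; 0ℤ)
open import Data.Integer.Divisibility using (_∣_)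
open import Data.List using (List; []; _∷_; length)
open import Data.Product using (Σ; _×_; ∃)
open import Relation.Binary.PropositionalEquality using (_≡_)
open import Relation.Nullary using (¬_)

-- A polynomial in ℤ[x] is its coefficient list, constant term first,
-- in canonical form: the last (leading) coefficient is nonzero.
Poly : Set
Poly = List ℤ

lead : Poly → ℤ
lead []           = 0ℤ
lead (a ∷ [])     = a
lead (a ∷ b ∷ cs) = lead (b ∷ cs)

eval : Poly → ℤ → ℤ
eval []       x = 0ℤ
eval (a ∷ cs) x = a + x * eval cs x

iterate : Poly → ℕ → ℤ → ℤ
iterate u zero    r = r
iterate u (suc k) r = eval u (iterate u k r)

DegreeAtLeast1 : Poly → Set
DegreeAtLeast1 u = ¬ (lead u ≡ 0ℤ) × (2 ℕ.≤ length u)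

LocallyNilpotentAt : Poly → ℤ → Set
LocallyNilpotentAt u r =
  (p : ℕ) → Prime p → ∃ λ k → (+ p) ∣ iterate u (suc k) r

NilpotentAt : Poly → ℤ → Set
NilpotentAt u r = ∃ λ k → iterate u (suc k) r ≡ 0ℤ

InS : ℤ → Poly → Set
InS r u = DegreeAtLeast1 u × LocallyNilpotentAt u r × ¬ NilpotentAt u r

IsSingleton : (Poly → Set) → Set
IsSingleton P = Σ Poly λ u → P u × ((v : Poly) → P v → v ≡ u)

{-# OPTIONS --safe #-}
-- If u is locally nilpotent but not nilpotent at 1, its orbit aᵢ = u⁽ⁱ⁾(1) is 1, 2, 3, …
-- Suppose aᵢ = i + 1 for i ≤ n and let c = aₙ₊₁. A prime dividing c - aⱼ (j ≤ n) makes the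
-- orbit periodic modulo it from j on, so by local nilpotence it divides some aᵢ with i ≤ n and
-- is at most n + 1; with a prime above n + 1 and non-nilpotence this shows c ∉ {0, …, n + 1}.
-- Also aₙ - aₜ ∣ aₙ₊₁ - aₜ₊₁ gives m ∣ c - (n + 2) for 1 ≤ m ≤ n. Hence the only possible
-- prime factor of c - (n + 1) is n + 1, and if it occurs then c - 1 has no prime factor at all;
-- so c - (n + 1) = 1.
-- Thus u(k) = k + 1 for all k ≥ 1, i.e. u = x + 1. Conjugating by x ↦ -x handles r = -1.
module Submission where

open import Defs
open import Data.Empty using (⊥; ⊥-elim)
open import Data.Integer using (ℤ; +_; -_; -[1+_]; _+_; _-_; _*_; 0ℤ; 1ℤ; -1ℤ; ∣_∣)
import Data.Integer.Properties as ℤP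
open import Data.Integer.Divisibility using () renaming (_∣_ to _∣ᵤ_)
open import Data.Integer.Divisibility.Signed
  using (_∣_; divides; ∣-refl; ∣-trans; ∣m∣n⇒∣m+n; ∣m∣n⇒∣m-n; ∣m⇒∣-m; ∣n⇒∣m*n; ∣m⇒∣m*n; ∣ᵤ⇒∣; ∣⇒∣ᵤ)
open import Data.Integer.Tactic.RingSolver using (solve-∀)
open import Data.List using ([]; _∷_; length)
open import Data.List.Relation.Unary.All using (All; []; _∷_)
open import Data.Nat as ℕ using (ℕ; zero; suc; z≤n; s≤s; _!)
import Data.Nat.Divisibility as ℕD
open import Data.Nat.Induction using (<-rec)
open import Data.Nat.ListAction using (product)
open import Data.Nat.Primality using (Prime; prime⇒nonZero; prime⇒nonTrivial; prime⇒irreducible)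
open import Data.Nat.Primality.Factorisation using (PrimeFactorisation; factorise)
import Data.Nat.Properties as ℕP
open import Data.Product using (_×_; _,_; ∃; proj₁; proj₂)
open import Data.Sum using (_⊎_; inj₁; inj₂; [_,_]′)
open import Relation.Binary.PropositionalEquality
open import Relation.Nullary using (yes; no; ¬_)

∣m∣m-n⇒∣n : ∀ {d x y} → d ∣ x → d ∣ x - y → d ∣ y
∣m∣m-n⇒∣n {d} {x} {y} d∣x d∣x-y = subst (d ∣_) (x-[x-y]≡y x y) (∣m∣n⇒∣m-n d∣x d∣x-y)
  where
  x-[x-y]≡y : ∀ x y → x - (x - y) ≡ y
  x-[x-y]≡y = solve-∀

i-j≡k⇒i≡k+j : ∀ {i j k} → i - j ≡ k → i ≡ k + j
i-j≡k⇒i≡k+j {i} {j} refl = i≡i-j+j i j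
  where
  i≡i-j+j : ∀ i j → i ≡ i - j + j
  i≡i-j+j = solve-∀

sub∣eval-sub : ∀ u x y → x - y ∣ eval u x - eval u y
sub∣eval-sub []       x y = divides 0ℤ refl
sub∣eval-sub (a ∷ cs) x y =
  subst (x - y ∣_) (sym (split a x y (eval cs x) (eval cs y)))
        (∣m∣n⇒∣m+n (∣m⇒∣m*n (eval cs x) ∣-refl) (∣n⇒∣m*n y (sub∣eval-sub cs x y)))
  where
  split : ∀ a x y X Y → (a + x * X) - (a + y * Y) ≡ (x - y) * X + y * (X - Y)
  split = solve-∀

iterate-+ : ∀ u t m r → iterate u (t ℕ.+ m) r ≡ iterate u t (iterate u m r)
iterate-+ u zero    m r = refl
iterate-+ u (suc t) m r = cong (eval u) (iterate-+ u t m r)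

sub∣iterate-sub : ∀ u t x y → x - y ∣ iterate u t x - iterate u t y
sub∣iterate-sub u zero    x y = ∣-refl
sub∣iterate-sub u (suc t) x y = ∣-trans (sub∣iterate-sub u t x y) (sub∣eval-sub u _ _)

module _ (u : Poly) (r : ℤ) where

  private
    a : ℕ → ℤ
    a m = iterate u m r

  ∣-orbit-shift : ∀ {p N j} → p ∣ a N - a j → ∀ t → p ∣ a (t ℕ.+ N) - a (t ℕ.+ j)
  ∣-orbit-shift {p} {N} {j} d t rewrite iterate-+ u t N r | iterate-+ u t j r =
    ∣-trans d (sub∣iterate-sub u t (a N) (a j))

  -- By ∣-orbit-shift, divisibility of the orbit by p passes from an index m ≥ N down to m - (N - j).
  ∣-orbit-below : ∀ {p N j} → j ℕ.< N → p ∣ a N - a j →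
                  ∀ m → p ∣ a m → ∃ λ i → i ℕ.< N × p ∣ a i
  ∣-orbit-below {p} {N} {j} j<N d = <-rec _ fold
    where
    fold : ∀ m → (∀ {m′} → m′ ℕ.< m → p ∣ a m′ → ∃ λ i → i ℕ.< N × p ∣ a i) →
           p ∣ a m → ∃ λ i → i ℕ.< N × p ∣ a i
    fold m ih p∣aₘ with m ℕ.<? N
    ... | yes m<N = m , m<N , p∣aₘ
    ... | no  m≮N = ih t+j<m (∣m∣m-n⇒∣n p∣aₜ₊N (∣-orbit-shift d t))
      where
      t = m ℕ.∸ N
      t+N≡m : t ℕ.+ N ≡ m
      t+N≡m = ℕP.m∸n+n≡m (ℕP.≮⇒≥ m≮N)
      p∣aₜ₊N : p ∣ a (t ℕ.+ N)
      p∣aₜ₊N = subst (λ k → p ∣ a k) (sym t+N≡m) p∣aₘ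
      t+j<m : t ℕ.+ j ℕ.< m
      t+j<m = subst (t ℕ.+ j ℕ.<_) t+N≡m (ℕP.+-monoʳ-< t j<N)

∣-all-positive⇒≡0 : ∀ x → (∀ k → + suc k ∣ x) → x ≡ 0ℤ
∣-all-positive⇒≡0 x h with ∣⇒∣ᵤ (h ∣ x ∣) | ∣ x ∣ in ∣x∣≡n
... | _          | zero  = ℤP.∣i∣≡0⇒i≡0 ∣x∣≡n
... | 1+∣x∣∣∣x∣ | suc n = ⊥-elim (ℕD.>⇒∤ (ℕP.n<1+n (suc n)) (subst (λ m → suc m ℕD.∣ m) ∣x∣≡n 1+∣x∣∣∣x∣))

-- s ∣ a - b for every positive s forces a = b.
constant-terms-≡ : ∀ a b (P Q : ℕ → ℤ) →
                   (∀ k → a + + suc k * P k ≡ b + + suc k * Q k) →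
                   a ≡ b × (∀ k → P k ≡ Q k)
constant-terms-≡ a b P Q h = a≡b , P≗Q
  where
  a-b≡ : ∀ k → a - b ≡ (Q k - P k) * + suc k
  a-b≡ k = begin
    a - b                                                ≡⟨ expand a b (+ suc k) (P k) (Q k) ⟩
    (a + + suc k * P k) - (b + + suc k * Q k) + (Q k - P k) * + suc k
      ≡⟨ cong (λ z → z - (b + + suc k * Q k) + (Q k - P k) * + suc k) (h k) ⟩
    (b + + suc k * Q k) - (b + + suc k * Q k) + (Q k - P k) * + suc k
      ≡⟨ cong (_+ (Q k - P k) * + suc k) (ℤP.+-inverseʳ (b + + suc k * Q k)) ⟩
    0ℤ + (Q k - P k) * + suc k                           ≡⟨ ℤP.+-identityˡ _ ⟩
    (Q k - P k) * + suc k                                ∎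
    where
    open ≡-Reasoning
    expand : ∀ a b s P Q → a - b ≡ (a + s * P) - (b + s * Q) + (Q - P) * s
    expand = solve-∀

  a≡b : a ≡ b
  a≡b = ℤP.i-j≡0⇒i≡j a b (∣-all-positive⇒≡0 (a - b) (λ k → divides (Q k - P k) (a-b≡ k)))

  P≗Q : ∀ k → P k ≡ Q k
  P≗Q k = sym (ℤP.i-j≡0⇒i≡j (Q k) (P k)
            (ℤP.*-cancelʳ-≡ (Q k - P k) 0ℤ (+ suc k) (trans (sym (a-b≡ k)) (ℤP.i≡j⇒i-j≡0 a≡b))))

AgreeOnPositives : Poly → Poly → Set
AgreeOnPositives u v = ∀ k → eval u (+ suc k) ≡ eval v (+ suc k)

vanishing-∷ : ∀ a q → AgreeOnPositives (a ∷ q) [] → a ≡ 0ℤ × AgreeOnPositives q []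
vanishing-∷ a q h =
  constant-terms-≡ a 0ℤ (λ k → eval q (+ suc k)) (λ _ → 0ℤ) (λ k → trans (h k) (sym (0+s*0≡0 (+ suc k))))
  where
  0+s*0≡0 : ∀ s → 0ℤ + s * 0ℤ ≡ 0ℤ
  0+s*0≡0 s = trans (ℤP.+-identityˡ (s * 0ℤ)) (ℤP.*-zeroʳ s)

vanishing⇒lead≡0 : ∀ u → AgreeOnPositives u [] → lead u ≡ 0ℤ
vanishing⇒lead≡0 []          _ = refl
vanishing⇒lead≡0 (a ∷ [])    h = proj₁ (vanishing-∷ a [] h)
vanishing⇒lead≡0 (a ∷ b ∷ q) h = vanishing⇒lead≡0 (b ∷ q) (proj₂ (vanishing-∷ a (b ∷ q) h))

mutual
  agreeOnPositives⇒≡ : ∀ u v → lead u ≢ 0ℤ → lead v ≢ 0ℤ → AgreeOnPositives u v → u ≡ v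
  agreeOnPositives⇒≡ []      _        lu _  _ = ⊥-elim (lu refl)
  agreeOnPositives⇒≡ (_ ∷ _) []       _  lv _ = ⊥-elim (lv refl)
  agreeOnPositives⇒≡ (a ∷ q) (b ∷ q′) lu lv h
    with constant-terms-≡ a b (λ k → eval q (+ suc k)) (λ k → eval q′ (+ suc k)) h
  ... | a≡b , q≗q′ = cong₂ _∷_ a≡b (tails-≡ q q′ lu lv q≗q′)

  tails-≡ : ∀ {a b} q q′ → lead (a ∷ q) ≢ 0ℤ → lead (b ∷ q′) ≢ 0ℤ → AgreeOnPositives q q′ → q ≡ q′
  tails-≡ []      []       _  _  _ = refl
  tails-≡ []      (c ∷ q′) _  lv h = ⊥-elim (lv (vanishing⇒lead≡0 (c ∷ q′) (λ k → sym (h k))))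
  tails-≡ (c ∷ q) []       lu _  h = ⊥-elim (lu (vanishing⇒lead≡0 (c ∷ q) h))
  tails-≡ (c ∷ q) (d ∷ q′) lu lv h = agreeOnPositives⇒≡ (c ∷ q) (d ∷ q′) lu lv h

prime⇒>1 : ∀ {q} → Prime q → 1 ℕ.< q
prime⇒>1 {q} pq = ℕ.nonTrivial⇒n>1 q {{prime⇒nonTrivial pq}}

primeFactor : ∀ n → 2 ℕ.≤ n → ∃ λ q → Prime q × q ℕD.∣ n
primeFactor n 2≤n = first (factors F) (isFactorisation F) (factorsPrime F)
  where
  open PrimeFactorisation
  F = factorise n {{ℕ.>-nonZero (ℕP.<-trans (s≤s z≤n) 2≤n)}}
  first : ∀ qs → n ≡ product qs → All Prime qs → ∃ λ q → Prime q × q ℕD.∣ n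
  first []       n≡1 _            = ⊥-elim (ℕP.<-irrefl (sym n≡1) 2≤n)
  first (q ∷ qs) n≡  (pq ∷ _) = q , pq , subst (q ℕD.∣_) (sym n≡) (ℕD.m∣m*n (product qs))

-- Euclid: a prime factor of n! + 1 exceeds n.
∃prime> : ∀ n → ∃ λ q → Prime q × n ℕ.< q
∃prime> n with primeFactor (n ! ℕ.+ 1) (ℕP.+-monoˡ-≤ 1 (ℕP.1≤n! n))
... | q , pq , q∣n!+1 with q ℕ.≤? n
...   | no  q≰n = q , pq , ℕP.≰⇒> q≰n
...   | yes q≤n = ⊥-elim (ℕP.<-irrefl (sym (ℕD.∣1⇒≡1 (ℕD.∣m+n∣m⇒∣n q∣n!+1 q∣n!))) (prime⇒>1 pq))
  where
  q∣n! : q ℕD.∣ n !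
  q∣n! = ℕD.∣-trans (m∣m! q {{prime⇒nonZero pq}}) (ℕD.m≤n⇒m!∣n! q≤n)
    where
    m∣m! : ∀ m → .{{ℕ.NonZero m}} → m ℕD.∣ m !
    m∣m! (suc m) = ℕD.m∣m*n (m !)

primeFactorℤ : ∀ z → 2 ℕ.≤ ∣ z ∣ → ∃ λ q → Prime q × + q ∣ z
primeFactorℤ z 2≤∣z∣ with primeFactor ∣ z ∣ 2≤∣z∣
... | q , pq , q∣∣z∣ = q , pq , ∣ᵤ⇒∣ q∣∣z∣

zero⊎±1⊎primeFactor : ∀ z → z ≡ 0ℤ ⊎ z ≡ 1ℤ ⊎ z ≡ -1ℤ ⊎ ∃ λ q → Prime q × + q ∣ z
zero⊎±1⊎primeFactor (+ 0)            = inj₁ refl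
zero⊎±1⊎primeFactor (+ 1)            = inj₂ (inj₁ refl)
zero⊎±1⊎primeFactor -[1+ 0 ] = inj₂ (inj₂ (inj₁ refl))
zero⊎±1⊎primeFactor z@(+ suc (suc n)) = inj₂ (inj₂ (inj₂ (primeFactorℤ z (s≤s (s≤s z≤n)))))
zero⊎±1⊎primeFactor z@(-[1+ suc n ]) = inj₂ (inj₂ (inj₂ (primeFactorℤ z (s≤s (s≤s z≤n)))))

module OrbitOfOne (u : Poly) (ln : LocallyNilpotentAt u (+ 1)) (nn : ¬ NilpotentAt u (+ 1)) where

  private
    a : ℕ → ℤ
    a m = iterate u m (+ 1)

  prime∣orbit-difference : ∀ {N j q} → j ℕ.< N → Prime q → + q ∣ a N - a j → ∃ λ i → i ℕ.< N × + q ∣ a i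
  prime∣orbit-difference j<N pq d with ln _ pq
  ... | k , q∣aₖ₊₁ = ∣-orbit-below u (+ 1) j<N d (suc k) (∣ᵤ⇒∣ q∣aₖ₊₁)

  module Step {n : ℕ} (a≡ : ∀ {i} → i ℕ.≤ n → a i ≡ + suc i) where

    c e X Y : ℤ
    c = a (suc n)
    e = c - + suc (suc n)
    X = c - + suc n
    Y = c - 1ℤ

    prime∣c-[j+1]⇒≤n+1 : ∀ {j q} → j ℕ.≤ n → Prime q → + q ∣ c - + suc j → q ℕ.≤ suc n
    prime∣c-[j+1]⇒≤n+1 {j} {q} j≤n pq d
      with prime∣orbit-difference (s≤s j≤n) pq (subst (λ z → + q ∣ c - z) (sym (a≡ j≤n)) d)
    ... | i , s≤s i≤n , q∣aᵢ = ℕP.≤-trans (ℕD.∣⇒≤ (∣⇒∣ᵤ (subst (+ q ∣_) (a≡ i≤n) q∣aᵢ))) (s≤s i≤n)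

    c≢≤n+1 : ∀ {m} → m ℕ.≤ suc n → c ≢ + m
    c≢≤n+1 {zero}  _          c≡0 = nn (n , c≡0)
    c≢≤n+1 {suc j} (s≤s j≤n) c≡m with ∃prime> (suc n)
    ... | q , pq , n+1<q =
      ℕP.<⇒≱ n+1<q (prime∣c-[j+1]⇒≤n+1 j≤n pq (subst (+ q ∣_) (sym (ℤP.i≡j⇒i-j≡0 c≡m)) (divides 0ℤ refl)))

    a[n]-a[t]∣c-a[t+1] : ∀ {t} → t ℕ.< n → + suc n - + suc t ∣ c - + suc (suc t)
    a[n]-a[t]∣c-a[t+1] {t} t<n =
      subst (λ z → + suc n - + suc t ∣ c - z) (a≡ t<n)
            (subst₂ (λ x y → x - y ∣ c - a (suc t)) (a≡ ℕP.≤-refl) (a≡ (ℕP.<⇒≤ t<n)) (sub∣eval-sub u (a n) (a t)))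

    m∣e : ∀ {m} → 1 ℕ.≤ m → m ℕ.≤ n → + m ∣ e
    m∣e {m} 1≤m m≤n =
      shift (+ n) (cong +_ (sym (ℕP.m∸n+n≡m m≤n))) (a[n]-a[t]∣c-a[t+1] (ℕP.∸-monoʳ-< 1≤m m≤n))
      where
      t = n ℕ.∸ m
      gap≡ : ∀ T M → 1ℤ + (T + M) - (1ℤ + T) ≡ M
      gap≡ = solve-∀
      shift≡ : ∀ c T M → c - (1ℤ + (1ℤ + T)) - M ≡ c - (1ℤ + (1ℤ + (T + M)))
      shift≡ = solve-∀
      shift : ∀ N → N ≡ + t + + m → 1ℤ + N - (1ℤ + + t) ∣ c - (1ℤ + (1ℤ + + t)) → + m ∣ c - (1ℤ + (1ℤ + N))
      shift _ refl d = subst (+ m ∣_) (shift≡ c (+ t) (+ m))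
        (∣m∣n⇒∣m-n (subst (_∣ c - (1ℤ + (1ℤ + + t))) (gap≡ (+ t) (+ m)) d) ∣-refl)

    prime∣X⇒≡n+1 : ∀ {q} → Prime q → + q ∣ X → q ≡ suc n
    prime∣X⇒≡n+1 {q} pq q∣X with q ℕ.≤? n
    ... | no  q≰n = ℕP.≤-antisym (prime∣c-[j+1]⇒≤n+1 ℕP.≤-refl pq q∣X) (ℕP.≰⇒> q≰n)
    ... | yes q≤n = ⊥-elim (ℕP.<-irrefl (sym (ℕD.∣1⇒≡1 (∣⇒∣ᵤ q∣1))) (prime⇒>1 pq))
      where
      X-e≡1 : ∀ c N → c - (1ℤ + N) - (c - (1ℤ + (1ℤ + N))) ≡ 1ℤ
      X-e≡1 = solve-∀
      q∣1 : + q ∣ 1ℤ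
      q∣1 = subst (+ q ∣_) (X-e≡1 c (+ n)) (∣m∣n⇒∣m-n q∣X (m∣e (ℕP.<⇒≤ (prime⇒>1 pq)) q≤n))

    n+1∤X : Prime (suc n) → + suc n ∣ X → ⊥
    n+1∤X pn n+1∣X with zero⊎±1⊎primeFactor Y
    ... | inj₁ Y≡0              = c≢≤n+1 (s≤s z≤n)    (i-j≡k⇒i≡k+j Y≡0)
    ... | inj₂ (inj₁ Y≡1)       = c≢≤n+1 (prime⇒>1 pn) (i-j≡k⇒i≡k+j Y≡1)
    ... | inj₂ (inj₂ (inj₁ Y≡-1)) = c≢≤n+1 z≤n         (i-j≡k⇒i≡k+j Y≡-1)
    ... | inj₂ (inj₂ (inj₂ (q , pq , q∣Y))) with q ℕ.≤? n
    ...   | yes q≤n = [ (λ q≡1 → ℕP.<-irrefl (sym q≡1) (prime⇒>1 pq)) , (λ q≡n+1 → ℕP.<-irrefl q≡n+1 (s≤s q≤n)) ]′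
                      (prime⇒irreducible pn q∣n+1)
      where
      Y-e≡n+1 : ∀ c N → c - 1ℤ - (c - (1ℤ + (1ℤ + N))) ≡ 1ℤ + N
      Y-e≡n+1 = solve-∀
      q∣n+1 : q ℕD.∣ suc n
      q∣n+1 = ∣⇒∣ᵤ (subst (+ q ∣_) (Y-e≡n+1 c (+ n)) (∣m∣n⇒∣m-n q∣Y (m∣e (ℕP.<⇒≤ (prime⇒>1 pq)) q≤n)))
    ...   | no  q≰n = ℕD.>⇒∤ {{ℕ.>-nonZero (ℕP.≤-pred (prime⇒>1 pn))}} (ℕP.n<1+n n) (∣⇒∣ᵤ n+1∣n)
      where
      Y-X≡n : ∀ c N → c - 1ℤ - (c - (1ℤ + N)) ≡ N
      Y-X≡n = solve-∀
      q≡n+1 : q ≡ suc n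
      q≡n+1 = ℕP.≤-antisym (prime∣c-[j+1]⇒≤n+1 z≤n pq q∣Y) (ℕP.≰⇒> q≰n)
      n+1∣n : + suc n ∣ + n
      n+1∣n = subst (+ suc n ∣_) (Y-X≡n c (+ n)) (∣m∣n⇒∣m-n (subst (λ p → + p ∣ Y) q≡n+1 q∣Y) n+1∣X)

    c≡n+2 : c ≡ + suc (suc n)
    c≡n+2 with zero⊎±1⊎primeFactor X
    ... | inj₁ X≡0                = ⊥-elim (c≢≤n+1 ℕP.≤-refl     (i-j≡k⇒i≡k+j X≡0))
    ... | inj₂ (inj₁ X≡1)         = i-j≡k⇒i≡k+j X≡1
    ... | inj₂ (inj₂ (inj₁ X≡-1)) = ⊥-elim (c≢≤n+1 (ℕP.n≤1+n n) (i-j≡k⇒i≡k+j X≡-1))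
    ... | inj₂ (inj₂ (inj₂ (q , pq , q∣X))) with prime∣X⇒≡n+1 pq q∣X
    ...   | refl = ⊥-elim (n+1∤X pq q∣X)

  iterate≡1+ : ∀ i → a i ≡ + suc i
  iterate≡1+ = <-rec _ step
    where
    step : ∀ i → (∀ {j} → j ℕ.< i → a j ≡ + suc j) → a i ≡ + suc i
    step zero    _  = refl
    step (suc n) ih = Step.c≡n+2 (λ i≤n → ih (s≤s i≤n))

x+1 : Poly
x+1 = 1ℤ ∷ 1ℤ ∷ []

eval-x+1 : ∀ x → eval x+1 x ≡ 1ℤ + x
eval-x+1 = horner
  where
  horner : ∀ x → 1ℤ + x * (1ℤ + x * 0ℤ) ≡ 1ℤ + x
  horner = solve-∀

iterate-x+1 : ∀ k → iterate x+1 k (+ 1) ≡ + suc k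
iterate-x+1 zero    = refl
iterate-x+1 (suc k) = trans (cong (eval x+1) (iterate-x+1 k)) (eval-x+1 (+ suc k))

x+1∈S[1] : InS (+ 1) x+1
x+1∈S[1] = ((λ ()) , s≤s (s≤s z≤n)) , locallyNilpotent , notNilpotent
  where
  locallyNilpotent : LocallyNilpotentAt x+1 (+ 1)
  locallyNilpotent p pp = p ℕ.∸ 2 , subst (λ z → p ℕD.∣ ∣ z ∣) (sym iterate≡p) ℕD.∣-refl
    where
    iterate≡p : iterate x+1 (suc (p ℕ.∸ 2)) (+ 1) ≡ + p
    iterate≡p = trans (iterate-x+1 (suc (p ℕ.∸ 2)))
                    (cong +_ (trans (ℕP.+-comm 2 (p ℕ.∸ 2)) (ℕP.m∸n+n≡m (prime⇒>1 pp))))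
  notNilpotent : ¬ NilpotentAt x+1 (+ 1)
  notNilpotent (k , iterate≡0) with trans (sym (iterate-x+1 (suc k))) iterate≡0
  ... | ()

InS[1]⇒≡x+1 : ∀ v → InS (+ 1) v → v ≡ x+1
InS[1]⇒≡x+1 v ((lead≢0 , _) , ln , nn) = agreeOnPositives⇒≡ v x+1 lead≢0 (λ ()) agree
  where
  open OrbitOfOne v ln nn
  agree : AgreeOnPositives v x+1
  agree k = begin
    eval v (+ suc k)                ≡⟨ cong (eval v) (sym (iterate≡1+ k)) ⟩
    iterate v (suc k) (+ 1)         ≡⟨ iterate≡1+ (suc k) ⟩
    1ℤ + + suc k                    ≡⟨ sym (eval-x+1 (+ suc k)) ⟩
    eval x+1 (+ suc k)              ∎
    where open ≡-Reasoning

mutual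
  mirror : Poly → Poly
  mirror []      = []
  mirror (a ∷ q) = - a ∷ mirrorArg q

  mirrorArg : Poly → Poly
  mirrorArg []      = []
  mirrorArg (a ∷ q) = a ∷ mirror q

mutual
  eval-mirror : ∀ u x → eval (mirror u) x ≡ - eval u (- x)
  eval-mirror []      x = refl
  eval-mirror (a ∷ q) x rewrite eval-mirrorArg q x = horner a x (eval q (- x))
    where
    horner : ∀ a x Q → - a + x * Q ≡ - (a + - x * Q)
    horner = solve-∀

  eval-mirrorArg : ∀ u x → eval (mirrorArg u) x ≡ eval u (- x)
  eval-mirrorArg []      x = refl
  eval-mirrorArg (a ∷ q) x rewrite eval-mirror q x = horner a x (eval q (- x))
    where
    horner : ∀ a x Q → a + x * - Q ≡ a + - x * Q
    horner = solve-∀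

mutual
  mirror-involutive : ∀ u → mirror (mirror u) ≡ u
  mirror-involutive []      = refl
  mirror-involutive (a ∷ q) = cong₂ _∷_ (ℤP.neg-involutive a) (mirrorArg-involutive q)

  mirrorArg-involutive : ∀ u → mirrorArg (mirrorArg u) ≡ u
  mirrorArg-involutive []      = refl
  mirrorArg-involutive (a ∷ q) = cong (a ∷_) (mirror-involutive q)

mutual
  length-mirror : ∀ u → length (mirror u) ≡ length u
  length-mirror []      = refl
  length-mirror (a ∷ q) = cong suc (length-mirrorArg q)

  length-mirrorArg : ∀ u → length (mirrorArg u) ≡ length u
  length-mirrorArg []      = refl
  length-mirrorArg (a ∷ q) = cong suc (length-mirror q)

mutual
  ∣lead-mirror∣ : ∀ u → ∣ lead (mirror u) ∣ ≡ ∣ lead u ∣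
  ∣lead-mirror∣ []          = refl
  ∣lead-mirror∣ (a ∷ [])    = ℤP.∣-i∣≡∣i∣ a
  ∣lead-mirror∣ (a ∷ b ∷ q) = ∣lead-mirrorArg∣ (b ∷ q)

  ∣lead-mirrorArg∣ : ∀ u → ∣ lead (mirrorArg u) ∣ ≡ ∣ lead u ∣
  ∣lead-mirrorArg∣ []          = refl
  ∣lead-mirrorArg∣ (a ∷ [])    = refl
  ∣lead-mirrorArg∣ (a ∷ b ∷ q) = ∣lead-mirror∣ (b ∷ q)

iterate-mirror : ∀ u k r → iterate (mirror u) k (- r) ≡ - iterate u k r
iterate-mirror u zero    r = refl
iterate-mirror u (suc k) r = begin
  eval (mirror u) (iterate (mirror u) k (- r)) ≡⟨ cong (eval (mirror u)) (iterate-mirror u k r) ⟩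
  eval (mirror u) (- iterate u k r)            ≡⟨ eval-mirror u _ ⟩
  - eval u (- - iterate u k r)                 ≡⟨ cong (λ z → - eval u z) (ℤP.neg-involutive _) ⟩
  - eval u (iterate u k r)                     ∎
  where open ≡-Reasoning

InS-mirror : ∀ r u → InS r u → InS (- r) (mirror u)
InS-mirror r u ((lead≢0 , 2≤len) , ln , nn) =
  (lead-mirror≢0 , subst (2 ℕ.≤_) (sym (length-mirror u)) 2≤len) , ln′ , nn′
  where
  lead-mirror≢0 : lead (mirror u) ≢ 0ℤ
  lead-mirror≢0 h = lead≢0 (ℤP.∣i∣≡0⇒i≡0 (trans (sym (∣lead-mirror∣ u)) (cong ∣_∣ h)))
  ln′ : LocallyNilpotentAt (mirror u) (- r)
  ln′ p pp with ln p pp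
  ... | k , p∣aₖ₊₁ = k , subst (+ p ∣ᵤ_) (sym (iterate-mirror u (suc k) r))
                            (∣⇒∣ᵤ (∣m⇒∣-m (∣ᵤ⇒∣ {+ p} {iterate u (suc k) r} p∣aₖ₊₁)))
  nn′ : ¬ NilpotentAt (mirror u) (- r)
  nn′ (k , aₖ₊₁≡0) = nn (k , trans (sym (ℤP.neg-involutive _)) (cong -_ (trans (sym (iterate-mirror u (suc k) r)) aₖ₊₁≡0)))

corollary4p3 : IsSingleton (InS (+ 1)) × IsSingleton (InS (- (+ 1)))
corollary4p3 =
  (x+1 , x+1∈S[1] , InS[1]⇒≡x+1) ,
  (mirror x+1 , InS-mirror (+ 1) x+1 x+1∈S[1] , InS[-1]⇒≡mirror-x+1)
  where
  InS[-1]⇒≡mirror-x+1 : ∀ v → InS (- (+ 1)) v → v ≡ mirror x+1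
  InS[-1]⇒≡mirror-x+1 v v∈S₋₁ = begin
    v                   ≡⟨ sym (mirror-involutive v) ⟩
    mirror (mirror v)   ≡⟨ cong mirror (InS[1]⇒≡x+1 (mirror v) (InS-mirror (- (+ 1)) v v∈S₋₁)) ⟩
    mirror x+1          ∎
    where open ≡-Reasoning
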